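{- Let $x,y$ be indeterminates and let $(M_{n,k})$ be defined by $M_{0,0}=1$, $M_{0,k}=0$ ($k>0$), and for $n\ge1$: $M_{n,0}=xM_{n-1,0}$ and $M_{n,k}=M_{n-1,k-1}+yM_{n-1,k}$ ($k\ge1$); so $M_{n,k}=0$ for $k>n$. Then for all integers $m,n\ge0$, $$\sum_{k=0}^{\min\{m,n\}}y^{2k}\det\begin{pmatrix}M_{n,k}&M_{n,k+1}\\ M_{m,k}&M_{m,k+1}\end{pmatrix}=\sum_{k=1}^{\max\{m,n\}}\left(\binom{m+n-k}{n}-\binom{m+n-k}{m}\right)x^{k-1}y^{m+n-k}.$$
   Context: Explicitly $M_{n,k}=\sum_{j=0}^{n-k}\binom{j+k-1}{j}x^{n-k-j}y^j$ for $n\ge k\ge 0$. Binomial coefficients $\binom{a}{b}$ with $b>a\ge0$ are $0$. -}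

module Defs where

open import Level using (Level)
open import Data.Nat using (ℕ; zero; suc; _⊔_; _⊓_; _∸_)
import Data.Nat as ℕ
open import Data.Nat.Combinatorics using (_C_)
import Algebra.Bundles
open Algebra.Bundles using (CommutativeRing)

module Poly {c ℓ : Level} (R : CommutativeRing c ℓ) where
  open CommutativeRing R using (Carrier; _+_; _*_; _-_; 0#; 1#; semiring)
  open import Algebra.Definitions.RawSemiring (Algebra.Bundles.Semiring.rawSemiring semiring) using (_×_; _^_) public

  M : Carrier → Carrier → ℕ → ℕ → Carrier
  M x y zero    zero    = 1#
  M x y zero    (suc k) = 0#
  M x y (suc n) zero    = x * M x y n zero
  M x y (suc n) (suc k) = M x y n k + y * M x y n (suc k)

  sumFrom : ℕ → ℕ → (ℕ → Carrier) → Carrier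
  sumFrom a zero      f = 0#
  sumFrom a (suc len) f = f a + sumFrom (suc a) len f

  LHS : Carrier → Carrier → ℕ → ℕ → Carrier
  LHS x y m n = sumFrom 0 (suc (m ⊓ n)) λ k →
    (y ^ (2 ℕ.* k)) * (M x y n k * M x y m (suc k) - M x y n (suc k) * M x y m k)

  RHS : Carrier → Carrier → ℕ → ℕ → Carrier
  RHS x y m n = sumFrom 1 (m ⊔ n) λ k →
    ((((m ℕ.+ n ∸ k) C n) × 1#) - (((m ℕ.+ n ∸ k) C m) × 1#)) * ((x ^ (k ∸ 1)) * (y ^ (m ℕ.+ n ∸ k)))

-- Both sides satisfy the Pascal-type recurrence  F(m+1, n+1) = y (F(m+1, n) + F(m, n+1)).
-- For the binomial side this is Pascal's rule applied to both binomials.  For the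
-- determinant side, expanding M(m+1, ·) and M(n+1, ·) by the defining recursion shows
-- that the k-th summand of the defect  F(m+1, n+1) - y (F(m+1, n) + F(m, n+1))  is
-- y^(2k) (d(k-1) - y² d(k)), with d(k) the k-th determinant of (m, n); the defect
-- telescopes to a single determinant beyond min(m, n), which vanishes.  On the boundary
-- m = 0 or n = 0 both sides reduce to ± M(·, 1), a geometric sum.
module Submission where

open import Defs
open import Level using (Level)
open import Algebra.Bundles using (CommutativeRing)
open import Data.Nat as ℕ using (ℕ; zero; suc; _<_; _≤_; _⊓_; _⊔_; _∸_; z≤n; s≤s)
import Data.Nat.Properties as ℕ
open import Data.Nat.Combinatorics using (_C_; k>n⇒nCk≡0; nCk+nC[k+1]≡[n+1]C[k+1])
open import Data.Sum using (inj₁; inj₂)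
open import Relation.Binary.PropositionalEquality as ≡ using (_≡_)

module IntegerCoefficientSolver {c ℓ : Level} (R : CommutativeRing c ℓ) where
  open import Algebra.Bundles using (RawRing)
  open import Data.Maybe using (Maybe; just; nothing)
  open import Data.Product as Product using (_,_)
  open import Relation.Nullary using (yes; no)
  open import Algebra.Solver.Ring.AlmostCommutativeRing
    using (AlmostCommutativeRing; fromCommutativeRing; _-Raw-AlmostCommutative⟶_)
  import Algebra.Solver.Ring
  open CommutativeRing R hiding (zero)
  open import Relation.Binary.Reasoning.Setoid setoid
  open import Algebra.Properties.Semiring.Mult semiring using (_×_; ×-homo-+; ×1-homo-*)
  open import Algebra.Properties.Ring ring using (-‿distribˡ-*; -‿distribʳ-*)
  open import Algebra.Properties.AbelianGroup +-abelianGroup using (⁻¹-anti-homo‿-; ⁻¹-∙-comm)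
  open import Algebra.Properties.Group +-group using (ε⁻¹≈ε; ⁻¹-involutive)
  open import Algebra.Solver.Ring.NaturalCoefficients.Default commutativeSemiring as ℕ-Solver
    using () renaming (_:+_ to _⊕_; _:*_ to _⊛_; _:=_ to _≐_)

  -- A pair (p , q) stands for the integer p - q.  Coefficients are kept with one entry
  -- zero, so that equal polynomials get syntactically equal normal forms.
  Pair : Set
  Pair = ℕ Product.× ℕ

  cancel : Pair → Pair
  cancel (suc p , suc q) = cancel (p , q)
  cancel (p , zero)      = (p , zero)
  cancel (zero , q)      = (zero , q)

  pairRing : RawRing _ _
  pairRing = record
    { Carrier = Pair
    ; _≈_     = _≡_
    ; _+_     = λ { (p , q) (p′ , q′) → cancel (p ℕ.+ p′ , q ℕ.+ q′) }
    ; _*_     = λ { (p , q) (p′ , q′) → cancel (p ℕ.* p′ ℕ.+ q ℕ.* q′ , p ℕ.* q′ ℕ.+ q ℕ.* p′) }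
    ; -_      = λ { (p , q) → (q , p) }
    ; 0#      = (0 , 0)
    ; 1#      = (1 , 0)
    }

  ⟦_⟧ᶜ : Pair → Carrier
  ⟦ (p , q) ⟧ᶜ = p × 1# - q × 1#

  cross : ∀ a b c d → a + d ≈ c + b → a - b ≈ c - d
  cross a b c d eq = begin
    a - b                  ≈⟨ +-identityʳ _ ⟨
    (a - b) + 0#           ≈⟨ +-congˡ (-‿inverseʳ d) ⟨
    (a - b) + (d - d)      ≈⟨ ℕ-Solver.solve 4 (λ a nb d nd → (a ⊕ nb) ⊕ (d ⊕ nd) ≐ (a ⊕ d) ⊕ (nb ⊕ nd)) refl a (- b) d (- d) ⟩
    (a + d) + (- b - d)    ≈⟨ +-congʳ eq ⟩
    (c + b) + (- b - d)    ≈⟨ ℕ-Solver.solve 4 (λ c b nb nd → (c ⊕ b) ⊕ (nb ⊕ nd) ≐ (c ⊕ nd) ⊕ (b ⊕ nb)) refl c b (- b) (- d) ⟩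
    (c - d) + (b - b)      ≈⟨ +-congˡ (-‿inverseʳ b) ⟩
    (c - d) + 0#           ≈⟨ +-identityʳ _ ⟩
    c - d                  ∎

  -‿+-interchange : ∀ a b c d → (a - b) + (c - d) ≈ (a + c) - (b + d)
  -‿+-interchange a b c d = begin
    (a - b) + (c - d)       ≈⟨ ℕ-Solver.solve 4 (λ a nb c nd → (a ⊕ nb) ⊕ (c ⊕ nd) ≐ (a ⊕ c) ⊕ (nb ⊕ nd)) refl a (- b) c (- d) ⟩
    (a + c) + (- b - d)     ≈⟨ +-congˡ (⁻¹-∙-comm b d) ⟩
    (a + c) - (b + d)       ∎

  -‿*-expand : ∀ a b c d → (a - b) * (c - d) ≈ (a * c + b * d) - (a * d + b * c)
  -‿*-expand a b c d = begin
    (a - b) * (c - d)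
      ≈⟨ ℕ-Solver.solve 4 (λ a nb c nd → (a ⊕ nb) ⊛ (c ⊕ nd) ≐ (a ⊛ c ⊕ nb ⊛ nd) ⊕ (a ⊛ nd ⊕ nb ⊛ c)) refl a (- b) c (- d) ⟩
    (a * c + - b * - d) + (a * - d + - b * c)
      ≈⟨ +-cong (+-congˡ -b*-d≈bd) (+-cong (-‿distribʳ-* a d) (-‿distribˡ-* b c)) ⟨
    (a * c + b * d) + (- (a * d) - b * c)
      ≈⟨ +-congˡ (⁻¹-∙-comm _ _) ⟩
    (a * c + b * d) - (a * d + b * c) ∎
    where
    -b*-d≈bd : b * d ≈ - b * - d
    -b*-d≈bd = begin
      b * d         ≈⟨ ⁻¹-involutive _ ⟨
      - - (b * d)   ≈⟨ -‿cong (-‿distribʳ-* b d) ⟩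
      - (b * - d)   ≈⟨ -‿distribˡ-* b (- d) ⟩
      - b * - d     ∎

  cancel-sound : ∀ p → ⟦ cancel p ⟧ᶜ ≈ ⟦ p ⟧ᶜ
  cancel-sound (suc p , suc q) = trans (cancel-sound (p , q)) (cross _ _ _ _
    (ℕ-Solver.solve 2 (λ a b → a ⊕ (ℕ-Solver.con 1 ⊕ b) ≐ (ℕ-Solver.con 1 ⊕ a) ⊕ b) refl (p × 1#) (q × 1#)))
  cancel-sound (zero  , zero)  = refl
  cancel-sound (suc p , zero)  = refl
  cancel-sound (zero  , suc q) = refl

  ⟦⟧-homomorphism : pairRing -Raw-AlmostCommutative⟶ fromCommutativeRing R
  ⟦⟧-homomorphism = record
    { ⟦_⟧    = ⟦_⟧ᶜ
    ; +-homo = λ { (p , q) (p′ , q′) → begin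
        ⟦ cancel (p ℕ.+ p′ , q ℕ.+ q′) ⟧ᶜ        ≈⟨ cancel-sound (p ℕ.+ p′ , q ℕ.+ q′) ⟩
        (p ℕ.+ p′) × 1# - (q ℕ.+ q′) × 1#         ≈⟨ +-cong (×-homo-+ 1# p p′) (-‿cong (×-homo-+ 1# q q′)) ⟩
        (p × 1# + p′ × 1#) - (q × 1# + q′ × 1#)   ≈⟨ -‿+-interchange _ _ _ _ ⟨
        ⟦ (p , q) ⟧ᶜ + ⟦ (p′ , q′) ⟧ᶜ             ∎ }
    ; *-homo = λ { (p , q) (p′ , q′) → begin
        ⟦ cancel (p ℕ.* p′ ℕ.+ q ℕ.* q′ , p ℕ.* q′ ℕ.+ q ℕ.* p′) ⟧ᶜ
          ≈⟨ cancel-sound (p ℕ.* p′ ℕ.+ q ℕ.* q′ , p ℕ.* q′ ℕ.+ q ℕ.* p′) ⟩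
        (p ℕ.* p′ ℕ.+ q ℕ.* q′) × 1# - (p ℕ.* q′ ℕ.+ q ℕ.* p′) × 1#
          ≈⟨ +-cong (×-sum-of-products p p′ q q′) (-‿cong (×-sum-of-products p q′ q p′)) ⟩
        ((p × 1#) * (p′ × 1#) + (q × 1#) * (q′ × 1#)) - ((p × 1#) * (q′ × 1#) + (q × 1#) * (p′ × 1#))
          ≈⟨ -‿*-expand _ _ _ _ ⟨
        ⟦ (p , q) ⟧ᶜ * ⟦ (p′ , q′) ⟧ᶜ ∎ }
    ; -‿homo = λ { (p , q) → sym (⁻¹-anti-homo‿- _ _) }
    ; 0-homo = -‿inverseʳ 0#
    ; 1-homo = trans (+-cong (+-identityʳ 1#) ε⁻¹≈ε) (+-identityʳ 1#)
    }
    where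
    ×-sum-of-products : ∀ a b c d → (a ℕ.* b ℕ.+ c ℕ.* d) × 1# ≈ (a × 1#) * (b × 1#) + (c × 1#) * (d × 1#)
    ×-sum-of-products a b c d = trans (×-homo-+ 1# (a ℕ.* b) (c ℕ.* d)) (+-cong (×1-homo-* a b) (×1-homo-* c d))

  ⟦⟧-≈? : ∀ p q → Maybe (⟦ p ⟧ᶜ ≈ ⟦ q ⟧ᶜ)
  ⟦⟧-≈? (p , q) (p′ , q′) with p ℕ.+ q′ ℕ.≟ p′ ℕ.+ q
  ... | yes eq = just (cross _ _ _ _ (begin
          p × 1# + q′ × 1#   ≈⟨ ×-homo-+ 1# p q′ ⟨
          (p ℕ.+ q′) × 1#    ≡⟨ ≡.cong (_× 1#) eq ⟩
          (p′ ℕ.+ q) × 1#    ≈⟨ ×-homo-+ 1# p′ q ⟩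
          p′ × 1# + q × 1#   ∎))
  ... | no _   = nothing

  open Algebra.Solver.Ring pairRing (fromCommutativeRing R) ⟦⟧-homomorphism ⟦⟧-≈? public
    using (solve; _:+_; _:*_; _:-_; :-_; _:=_)

module FiniteSums {c ℓ : Level} (R : CommutativeRing c ℓ) where
  open CommutativeRing R hiding (zero)
  open Poly R using (sumFrom)
  open IntegerCoefficientSolver R using (solve; _:+_; _:*_; :-_; _:=_)
  open import Algebra.Properties.Group +-group using (ε⁻¹≈ε)
  open import Relation.Binary.Reasoning.Setoid setoid

  ∑ : ℕ → (ℕ → Carrier) → Carrier
  ∑ zero    f = 0#
  ∑ (suc N) f = ∑ N f + f N

  ∑-cong : ∀ N {f g : ℕ → Carrier} → (∀ k → k < N → f k ≈ g k) → ∑ N f ≈ ∑ N g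
  ∑-cong zero    f≈g = refl
  ∑-cong (suc N) f≈g = +-cong (∑-cong N (λ k k<N → f≈g k (ℕ.m<n⇒m<1+n k<N))) (f≈g N ℕ.≤-refl)

  ∑-suc : ∀ N f → ∑ (suc N) f ≈ f 0 + ∑ N (λ k → f (suc k))
  ∑-suc zero    f = +-comm 0# (f 0)
  ∑-suc (suc N) f = trans (+-congʳ (∑-suc N f)) (+-assoc _ _ _)

  sumFrom≈∑ : ∀ a N f → sumFrom a N f ≈ ∑ N (λ k → f (a ℕ.+ k))
  sumFrom≈∑ a zero    f = refl
  sumFrom≈∑ a (suc N) f = trans
    (+-cong (reflexive (≡.cong f (≡.sym (ℕ.+-identityʳ a))))
            (trans (sumFrom≈∑ (suc a) N f) (∑-cong N (λ k _ → reflexive (≡.cong f (≡.sym (ℕ.+-suc a k)))))))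
    (sym (∑-suc N (λ k → f (a ℕ.+ k))))

  ∑-vanishing-tail : ∀ K N f → K ≤ N → (∀ k → K ≤ k → k < N → f k ≈ 0#) → ∑ N f ≈ ∑ K f
  ∑-vanishing-tail .zero zero    f z≤n  _      = refl
  ∑-vanishing-tail K     (suc N) f K≤1+N vanish with ℕ.m≤n⇒m<n∨m≡n K≤1+N
  ... | inj₂ ≡.refl = refl
  ... | inj₁ K<1+N  = begin
    ∑ N f + f N   ≈⟨ +-cong (∑-vanishing-tail K N f K≤N (λ k K≤k k<N → vanish k K≤k (ℕ.m<n⇒m<1+n k<N)))
                            (vanish N K≤N ℕ.≤-refl) ⟩
    ∑ K f + 0#    ≈⟨ +-identityʳ _ ⟩
    ∑ K f         ∎
    where
    K≤N : K ≤ N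
    K≤N = ℕ.s≤s⁻¹ K<1+N

  ∑-*-distribˡ : ∀ N a f → ∑ N (λ k → a * f k) ≈ a * ∑ N f
  ∑-*-distribˡ zero    a f = sym (zeroʳ a)
  ∑-*-distribˡ (suc N) a f = trans (+-congʳ (∑-*-distribˡ N a f)) (sym (distribˡ a _ _))

  ∑-+ : ∀ N f g → ∑ N (λ k → f k + g k) ≈ ∑ N f + ∑ N g
  ∑-+ zero    f g = sym (+-identityʳ 0#)
  ∑-+ (suc N) f g = trans (+-congʳ (∑-+ N f g))
    (solve 4 (λ F G u v → (F :+ G) :+ (u :+ v) := (F :+ u) :+ (G :+ v)) refl (∑ N f) (∑ N g) (f N) (g N))

  ∑-neg : ∀ N f → ∑ N (λ k → - f k) ≈ - ∑ N f
  ∑-neg zero    f = sym ε⁻¹≈ε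
  ∑-neg (suc N) f = trans (+-congʳ (∑-neg N f))
    (solve 2 (λ F u → (:- F) :+ (:- u) := :- (F :+ u)) refl (∑ N f) (f N))

module Identity {c ℓ : Level} (R : CommutativeRing c ℓ) (x y : CommutativeRing.Carrier R) where
  open CommutativeRing R hiding (zero)
  open Poly R
  open FiniteSums R
  open IntegerCoefficientSolver R using (solve; _:+_; _:*_; _:-_; :-_; _:=_)
  open import Algebra.Properties.Semiring.Mult semiring using (×-homo-+)
  open import Algebra.Properties.Ring ring using (-1*x≈-x)
  open import Algebra.Properties.Group +-group using (ε⁻¹≈ε; x∙y⁻¹≈ε⇒x≈y)
  open import Relation.Binary.Reasoning.Setoid setoid

  M-vanishing : ∀ {n k} → n < k → M x y n k ≈ 0#
  M-vanishing {zero}  {suc k} _ = refl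
  M-vanishing {suc n} {suc k} (s≤s n<k) = begin
    M x y n k + y * M x y n (suc k)  ≈⟨ +-cong (M-vanishing n<k) (*-congˡ (M-vanishing (ℕ.m<n⇒m<1+n n<k))) ⟩
    0# + y * 0#                      ≈⟨ trans (+-identityˡ _) (zeroʳ y) ⟩
    0#                               ∎

  M-zeroʳ : ∀ n → M x y n 0 ≈ x ^ n
  M-zeroʳ zero    = refl
  M-zeroʳ (suc n) = *-congˡ (M-zeroʳ n)

  geometric : ℕ → Carrier
  geometric n = ∑ n (λ j → x ^ j * y ^ (n ∸ suc j))

  M-oneʳ : ∀ n → M x y n 1 ≈ geometric n
  M-oneʳ zero    = refl
  M-oneʳ (suc n) = begin
    M x y n 0 + y * M x y n 1                              ≈⟨ +-cong (M-zeroʳ n) (*-congˡ (M-oneʳ n)) ⟩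
    x ^ n + y * geometric n                                ≈⟨ +-congˡ (∑-*-distribˡ n y _) ⟨
    x ^ n + ∑ n (λ j → y * (x ^ j * y ^ (n ∸ suc j)))      ≈⟨ +-congˡ (∑-cong n shift) ⟩
    x ^ n + ∑ n (λ j → x ^ j * y ^ (n ∸ j))                ≈⟨ +-comm _ _ ⟩
    ∑ n (λ j → x ^ j * y ^ (n ∸ j)) + x ^ n                ≈⟨ +-congˡ (*-identityʳ _) ⟨
    ∑ n (λ j → x ^ j * y ^ (n ∸ j)) + x ^ n * y ^ 0        ≡⟨ ≡.cong (λ e → ∑ n (λ j → x ^ j * y ^ (n ∸ j)) + x ^ n * y ^ e) (ℕ.n∸n≡0 n) ⟨
    geometric (suc n)                                      ∎
    where
    shift : ∀ j → j < n → y * (x ^ j * y ^ (n ∸ suc j)) ≈ x ^ j * y ^ (n ∸ j)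
    shift j j<n = begin
      y * (x ^ j * y ^ (n ∸ suc j))   ≈⟨ solve 3 (λ y X Y → y :* (X :* Y) := X :* (y :* Y)) refl y (x ^ j) _ ⟩
      x ^ j * y ^ suc (n ∸ suc j)     ≡⟨ ≡.cong (λ e → x ^ j * y ^ e) (ℕ.+-∸-assoc 1 j<n) ⟨
      x ^ j * y ^ (n ∸ j)             ∎

  difference-of-zeros : ∀ {a b} → a ≈ 0# → b ≈ 0# → a - b ≈ 0#
  difference-of-zeros a≈0 b≈0 = trans (+-cong a≈0 (-‿cong b≈0)) (-‿inverseʳ 0#)

  det : ℕ → ℕ → ℕ → Carrier
  det m n k = M x y n k * M x y m (suc k) - M x y n (suc k) * M x y m k

  det-vanishing : ∀ m n k → m ⊓ n < k → det m n k ≈ 0#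
  det-vanishing m n k min<k with ℕ.≤-total m n
  ... | inj₁ m≤n = difference-of-zeros
    (trans (*-congˡ (M-vanishing (ℕ.m<n⇒m<1+n m<k))) (zeroʳ _)) (trans (*-congˡ (M-vanishing m<k)) (zeroʳ _))
    where m<k : m < k
          m<k = ≡.subst (_< k) (ℕ.m≤n⇒m⊓n≡m m≤n) min<k
  ... | inj₂ n≤m = difference-of-zeros
    (trans (*-congʳ (M-vanishing n<k)) (zeroˡ _)) (trans (*-congʳ (M-vanishing (ℕ.m<n⇒m<1+n n<k))) (zeroˡ _))
    where n<k : n < k
          n<k = ≡.subst (_< k) (ℕ.m≥n⇒m⊓n≡n n≤m) min<k

  det-pascal₀ : ∀ m n → det (suc m) (suc n) 0 - y * (det (suc m) n 0 + det m (suc n) 0) ≈ - (y * y * det m n 0)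
  det-pascal₀ m n = solve 6
    (λ x y a₀ a₁ b₀ b₁ →
      ((x :* a₀) :* (b₀ :+ y :* b₁) :- (a₀ :+ y :* a₁) :* (x :* b₀))
        :- y :* ((a₀ :* (b₀ :+ y :* b₁) :- a₁ :* (x :* b₀)) :+ ((x :* a₀) :* b₁ :- (a₀ :+ y :* a₁) :* b₀))
      := :- (y :* y :* (a₀ :* b₁ :- a₁ :* b₀)))
    refl x y (M x y n 0) (M x y n 1) (M x y m 0) (M x y m 1)

  det-pascal : ∀ m n k →
    det (suc m) (suc n) (suc k) - y * (det (suc m) n (suc k) + det m (suc n) (suc k)) ≈ det m n k - y * y * det m n (suc k)
  det-pascal m n k = solve 7
    (λ y a₀ a₁ a₂ b₀ b₁ b₂ →
      ((a₀ :+ y :* a₁) :* (b₁ :+ y :* b₂) :- (a₁ :+ y :* a₂) :* (b₀ :+ y :* b₁))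
        :- y :* ((a₁ :* (b₁ :+ y :* b₂) :- a₂ :* (b₀ :+ y :* b₁)) :+ ((a₀ :+ y :* a₁) :* b₂ :- (a₁ :+ y :* a₂) :* b₁))
      := (a₀ :* b₁ :- a₁ :* b₀) :- y :* y :* (a₁ :* b₂ :- a₂ :* b₁))
    refl y (M x y n k) (M x y n (suc k)) (M x y n (suc (suc k))) (M x y m k) (M x y m (suc k)) (M x y m (suc (suc k)))

  lhsSum : ℕ → ℕ → ℕ → Carrier
  lhsSum m n N = ∑ N (λ k → y ^ (2 ℕ.* k) * det m n k)

  LHS≈lhsSum : ∀ m n N → suc (m ⊓ n) ≤ N → LHS x y m n ≈ lhsSum m n N
  LHS≈lhsSum m n N min<N = trans (sumFrom≈∑ 0 (suc (m ⊓ n)) _) (sym (∑-vanishing-tail _ N _ min<N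
    (λ k min<k _ → trans (*-congˡ (det-vanishing m n k min<k)) (zeroʳ _))))

  lhsSum-one : ∀ m n → lhsSum m n 1 ≈ det m n 0
  lhsSum-one m n = trans (+-identityˡ _) (*-identityˡ _)

  lhsSum-pascal-defect : ∀ m n K →
    lhsSum (suc m) (suc n) (suc K) - y * (lhsSum (suc m) n (suc K) + lhsSum m (suc n) (suc K))
      ≈ - (y ^ (2 ℕ.* suc K) * det m n K)
  lhsSum-pascal-defect m n zero = begin
    lhsSum (suc m) (suc n) 1 - y * (lhsSum (suc m) n 1 + lhsSum m (suc n) 1)
      ≈⟨ +-cong (lhsSum-one (suc m) (suc n)) (-‿cong (*-congˡ (+-cong (lhsSum-one (suc m) n) (lhsSum-one m (suc n))))) ⟩
    det (suc m) (suc n) 0 - y * (det (suc m) n 0 + det m (suc n) 0)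
      ≈⟨ det-pascal₀ m n ⟩
    - (y * y * det m n 0)
      ≈⟨ -‿cong (*-congʳ (*-congˡ (*-identityʳ y))) ⟨
    - (y ^ 2 * det m n 0) ∎
  lhsSum-pascal-defect m n (suc K) = begin
    (s₁ + P * d₁) - y * ((s₂ + P * d₂) + (s₃ + P * d₃))
      ≈⟨ solve 7 (λ y s₁ a s₂ b s₃ c → (s₁ :+ a) :- y :* ((s₂ :+ b) :+ (s₃ :+ c)) := (s₁ :- y :* (s₂ :+ s₃)) :+ (a :- y :* (b :+ c)))
               refl y s₁ (P * d₁) s₂ (P * d₂) s₃ (P * d₃) ⟩
    (s₁ - y * (s₂ + s₃)) + (P * d₁ - y * (P * d₂ + P * d₃))
      ≈⟨ +-cong (lhsSum-pascal-defect m n K)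
                (solve 5 (λ y P a b c → P :* a :- y :* (P :* b :+ P :* c) := P :* (a :- y :* (b :+ c))) refl y P d₁ d₂ d₃) ⟩
    - (P * det m n K) + P * (d₁ - y * (d₂ + d₃))
      ≈⟨ +-congˡ (*-congˡ (det-pascal m n K)) ⟩
    - (P * det m n K) + P * (det m n K - y * y * det m n (suc K))
      ≈⟨ solve 4 (λ y P a b → (:- (P :* a)) :+ P :* (a :- y :* y :* b) := :- (y :* (y :* P) :* b)) refl y P (det m n K) (det m n (suc K)) ⟩
    - (y * (y * P) * det m n (suc K))
      ≡⟨ ≡.cong (λ e → - (y ^ e * det m n (suc K))) (ℕ.*-suc 2 (suc K)) ⟨
    - (y ^ (2 ℕ.* suc (suc K)) * det m n (suc K)) ∎
    where
    P s₁ s₂ s₃ d₁ d₂ d₃ : Carrier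
    P  = y ^ (2 ℕ.* suc K)
    s₁ = lhsSum (suc m) (suc n) (suc K)
    s₂ = lhsSum (suc m) n (suc K)
    s₃ = lhsSum m (suc n) (suc K)
    d₁ = det (suc m) (suc n) (suc K)
    d₂ = det (suc m) n (suc K)
    d₃ = det m (suc n) (suc K)

  LHS-pascal : ∀ m n → LHS x y (suc m) (suc n) ≈ y * (LHS x y (suc m) n + LHS x y m (suc n))
  LHS-pascal m n = begin
    LHS x y (suc m) (suc n)                   ≈⟨ LHS≈lhsSum (suc m) (suc n) (suc K) ℕ.≤-refl ⟩
    lhsSum (suc m) (suc n) (suc K)            ≈⟨ x∙y⁻¹≈ε⇒x≈y _ _ defect≈0 ⟩
    y * (lhsSum (suc m) n (suc K) + lhsSum m (suc n) (suc K))
      ≈⟨ *-congˡ (+-cong (LHS≈lhsSum (suc m) n (suc K) (s≤s (ℕ.⊓-monoʳ-≤ (suc m) (ℕ.n≤1+n n))))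
                         (LHS≈lhsSum m (suc n) (suc K) (s≤s (ℕ.⊓-monoˡ-≤ (suc n) (ℕ.n≤1+n m))))) ⟨
    y * (LHS x y (suc m) n + LHS x y m (suc n)) ∎
    where
    K : ℕ
    K = suc (m ⊓ n)
    -- The determinant left over by the telescoping lies beyond min(m, n).
    defect≈0 : lhsSum (suc m) (suc n) (suc K) - y * (lhsSum (suc m) n (suc K) + lhsSum m (suc n) (suc K)) ≈ 0#
    defect≈0 = begin
      _                                  ≈⟨ lhsSum-pascal-defect m n K ⟩
      - (y ^ (2 ℕ.* suc K) * det m n K)  ≈⟨ -‿cong (trans (*-congˡ (det-vanishing m n K ℕ.≤-refl)) (zeroʳ _)) ⟩
      - 0#                               ≈⟨ ε⁻¹≈ε ⟩
      0#                                 ∎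

  binomialDifference : ℕ → ℕ → ℕ → Carrier
  binomialDifference m n s = (s C n) × 1# - (s C m) × 1#

  C×1-pascal : ∀ s k → (suc s C suc k) × 1# ≈ (s C k) × 1# + (s C suc k) × 1#
  C×1-pascal s k = begin
    (suc s C suc k) × 1#                 ≡⟨ ≡.cong (_× 1#) (nCk+nC[k+1]≡[n+1]C[k+1] s k) ⟨
    (s C k ℕ.+ s C suc k) × 1#           ≈⟨ ×-homo-+ 1# (s C k) (s C suc k) ⟩
    (s C k) × 1# + (s C suc k) × 1#      ∎

  binomialDifference-pascal : ∀ m n s →
    binomialDifference (suc m) (suc n) (suc s) ≈ binomialDifference (suc m) n s + binomialDifference m (suc n) s
  binomialDifference-pascal m n s = begin
    (suc s C suc n) × 1# - (suc s C suc m) × 1#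
      ≈⟨ +-cong (C×1-pascal s n) (-‿cong (C×1-pascal s m)) ⟩
    ((s C n) × 1# + (s C suc n) × 1#) - ((s C m) × 1# + (s C suc m) × 1#)
      ≈⟨ solve 4 (λ a b d e → (a :+ b) :- (d :+ e) := (a :- e) :+ (b :- d)) refl _ _ _ _ ⟩
    binomialDifference (suc m) n s + binomialDifference m (suc n) s ∎

  binomialDifference-vanishing : ∀ m n s → s < m → s < n → binomialDifference m n s ≈ 0#
  binomialDifference-vanishing m n s s<m s<n =
    difference-of-zeros (reflexive (≡.cong (_× 1#) (k>n⇒nCk≡0 s<n))) (reflexive (≡.cong (_× 1#) (k>n⇒nCk≡0 s<m)))

  binomialMonomial : ℕ → ℕ → ℕ → ℕ → Carrier
  binomialMonomial m n s j = binomialDifference m n s * (x ^ j * y ^ s)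

  binomialMonomial-pascal : ∀ m n s j →
    binomialMonomial (suc m) (suc n) (suc s) j ≈ y * (binomialMonomial (suc m) n s j + binomialMonomial m (suc n) s j)
  binomialMonomial-pascal m n s j = begin
    binomialDifference (suc m) (suc n) (suc s) * (x ^ j * (y * y ^ s))
      ≈⟨ *-congʳ (binomialDifference-pascal m n s) ⟩
    (binomialDifference (suc m) n s + binomialDifference m (suc n) s) * (x ^ j * (y * y ^ s))
      ≈⟨ solve 5 (λ y a b X Y → (a :+ b) :* (X :* (y :* Y)) := y :* (a :* (X :* Y) :+ b :* (X :* Y))) refl y _ _ (x ^ j) (y ^ s) ⟩
    y * (binomialMonomial (suc m) n s j + binomialMonomial m (suc n) s j) ∎

  -- The (j+1)-st summand of RHS m n.
  rhsTerm : ℕ → ℕ → ℕ → Carrier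
  rhsTerm m n j = binomialMonomial m n (m ℕ.+ n ∸ suc j) j

  rhsSum : ℕ → ℕ → ℕ → Carrier
  rhsSum m n K = ∑ K (rhsTerm m n)

  RHS≈rhsSum : ∀ m n K → m ⊔ n ≤ K → K ≤ m ℕ.+ n → RHS x y m n ≈ rhsSum m n K
  RHS≈rhsSum m n K max≤K K≤m+n = trans (sumFrom≈∑ 1 (m ⊔ n) _) (sym (∑-vanishing-tail (m ⊔ n) K (rhsTerm m n) max≤K vanish))
    where
    vanish : ∀ j → m ⊔ n ≤ j → j < K → rhsTerm m n j ≈ 0#
    vanish j max≤j j<K = trans (*-congʳ (binomialDifference-vanishing m n _ s<m s<n)) (zeroˡ _)
      where
      1+j≤m+n : suc j ≤ m ℕ.+ n
      1+j≤m+n = ℕ.≤-trans j<K K≤m+n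
      s<n : m ℕ.+ n ∸ suc j < n
      s<n = ≡.subst (m ℕ.+ n ∸ suc j <_) (ℕ.m+n∸m≡n m n)
              (ℕ.∸-monoʳ-< (s≤s (ℕ.≤-trans (ℕ.m≤m⊔n m n) max≤j)) 1+j≤m+n)
      s<m : m ℕ.+ n ∸ suc j < m
      s<m = ≡.subst (m ℕ.+ n ∸ suc j <_) (ℕ.m+n∸n≡m m n)
              (ℕ.∸-monoʳ-< (s≤s (ℕ.≤-trans (ℕ.m≤n⊔m m n) max≤j)) 1+j≤m+n)

  rhsTerm-pascal : ∀ m n j → j ≤ m ℕ.+ n →
    rhsTerm (suc m) (suc n) j ≈ y * (rhsTerm (suc m) n j + rhsTerm m (suc n) j)
  rhsTerm-pascal m n j j≤m+n = begin
    binomialMonomial (suc m) (suc n) (m ℕ.+ suc n ∸ j) j          ≡⟨ ≡.cong (λ s → binomialMonomial (suc m) (suc n) s j) s+1≡ ⟩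
    binomialMonomial (suc m) (suc n) (suc (m ℕ.+ n ∸ j)) j        ≈⟨ binomialMonomial-pascal m n (m ℕ.+ n ∸ j) j ⟩
    y * (binomialMonomial (suc m) n (m ℕ.+ n ∸ j) j + binomialMonomial m (suc n) (m ℕ.+ n ∸ j) j)
      ≡⟨ ≡.cong (λ s → y * (binomialMonomial (suc m) n (m ℕ.+ n ∸ j) j + binomialMonomial m (suc n) (s ∸ suc j) j)) (ℕ.+-suc m n) ⟨
    y * (rhsTerm (suc m) n j + rhsTerm m (suc n) j) ∎
    where
    s+1≡ : m ℕ.+ suc n ∸ j ≡ suc (m ℕ.+ n ∸ j)
    s+1≡ = ≡.trans (≡.cong (_∸ j) (ℕ.+-suc m n)) (ℕ.+-∸-assoc 1 j≤m+n)

  RHS-pascal : ∀ m n → RHS x y (suc m) (suc n) ≈ y * (RHS x y (suc m) n + RHS x y m (suc n))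
  RHS-pascal m n = begin
    RHS x y (suc m) (suc n)          ≈⟨ RHS≈rhsSum (suc m) (suc n) K ℕ.≤-refl (ℕ.m⊔n≤m+n (suc m) (suc n)) ⟩
    rhsSum (suc m) (suc n) K         ≈⟨ ∑-cong K (λ j j<K → rhsTerm-pascal m n j (ℕ.≤-trans (ℕ.s≤s⁻¹ j<K) (ℕ.m⊔n≤m+n m n))) ⟩
    ∑ K (λ j → y * (rhsTerm (suc m) n j + rhsTerm m (suc n) j))
                                     ≈⟨ ∑-*-distribˡ K y _ ⟩
    y * ∑ K (λ j → rhsTerm (suc m) n j + rhsTerm m (suc n) j)
                                     ≈⟨ *-congˡ (∑-+ K (rhsTerm (suc m) n) (rhsTerm m (suc n))) ⟩
    y * (rhsSum (suc m) n K + rhsSum m (suc n) K)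
      ≈⟨ *-congˡ (+-cong (RHS≈rhsSum (suc m) n K (ℕ.⊔-monoʳ-≤ (suc m) (ℕ.n≤1+n n)) (s≤s (ℕ.m⊔n≤m+n m n)))
                         (RHS≈rhsSum m (suc n) K (ℕ.⊔-monoˡ-≤ (suc n) (ℕ.n≤1+n m))
                                                 (ℕ.≤-trans (s≤s (ℕ.m⊔n≤m+n m n)) (ℕ.≤-reflexive (≡.sym (ℕ.+-suc m n)))))) ⟨
    y * (RHS x y (suc m) n + RHS x y m (suc n)) ∎
    where
    K : ℕ
    K = suc (m ⊔ n)

  LHS-zeroʳ : ∀ m → LHS x y m 0 ≈ M x y m 1
  LHS-zeroʳ m = begin
    LHS x y m 0                       ≈⟨ LHS≈lhsSum m 0 1 (s≤s (ℕ.≤-reflexive (ℕ.⊓-zeroʳ m))) ⟩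
    lhsSum m 0 1                      ≈⟨ lhsSum-one m 0 ⟩
    1# * M x y m 1 - 0# * M x y m 0   ≈⟨ +-cong (*-identityˡ _) (trans (-‿cong (zeroˡ _)) ε⁻¹≈ε) ⟩
    M x y m 1 + 0#                    ≈⟨ +-identityʳ _ ⟩
    M x y m 1                         ∎

  LHS-zeroˡ : ∀ n → LHS x y 0 n ≈ - M x y n 1
  LHS-zeroˡ n = begin
    LHS x y 0 n                       ≈⟨ LHS≈lhsSum 0 n 1 (s≤s z≤n) ⟩
    lhsSum 0 n 1                      ≈⟨ lhsSum-one 0 n ⟩
    M x y n 0 * 0# - M x y n 1 * 1#   ≈⟨ +-cong (zeroʳ _) (-‿cong (*-identityʳ _)) ⟩
    0# - M x y n 1                    ≈⟨ +-identityˡ _ ⟩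
    - M x y n 1                       ∎

  RHS-zeroʳ : ∀ m → RHS x y m 0 ≈ geometric m
  RHS-zeroʳ m = trans (RHS≈rhsSum m 0 m (ℕ.≤-reflexive (ℕ.⊔-identityʳ m)) (ℕ.m≤m+n m 0)) (∑-cong m rhsTerm≈)
    where
    rhsTerm≈ : ∀ j → j < m → rhsTerm m 0 j ≈ x ^ j * y ^ (m ∸ suc j)
    rhsTerm≈ j j<m = begin
      binomialMonomial m 0 (m ℕ.+ 0 ∸ suc j) j                      ≡⟨ ≡.cong (λ e → binomialMonomial m 0 (e ∸ suc j) j) (ℕ.+-identityʳ m) ⟩
      binomialDifference m 0 s * (x ^ j * y ^ s)        ≈⟨ *-congʳ bd≈1 ⟩
      1# * (x ^ j * y ^ s)                              ≈⟨ *-identityˡ _ ⟩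
      x ^ j * y ^ s                                     ∎
      where
      s : ℕ
      s = m ∸ suc j
      bd≈1 : binomialDifference m 0 s ≈ 1#
      bd≈1 = begin
        (1# + 0#) - (s C m) × 1#   ≈⟨ +-cong (+-identityʳ 1#) (-‿cong (reflexive (≡.cong (_× 1#) (k>n⇒nCk≡0 (ℕ.∸-monoʳ-< (s≤s z≤n) j<m))))) ⟩
        1# - 0#                    ≈⟨ +-congˡ ε⁻¹≈ε ⟩
        1# + 0#                    ≈⟨ +-identityʳ 1# ⟩
        1#                         ∎

  RHS-zeroˡ : ∀ n → RHS x y 0 n ≈ - geometric n
  RHS-zeroˡ n = begin
    RHS x y 0 n                                  ≈⟨ RHS≈rhsSum 0 n n ℕ.≤-refl ℕ.≤-refl ⟩
    rhsSum 0 n n                                 ≈⟨ ∑-cong n rhsTerm≈ ⟩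
    ∑ n (λ j → - (x ^ j * y ^ (n ∸ suc j)))      ≈⟨ ∑-neg n _ ⟩
    - geometric n                                ∎
    where
    rhsTerm≈ : ∀ j → j < n → rhsTerm 0 n j ≈ - (x ^ j * y ^ (n ∸ suc j))
    rhsTerm≈ j j<n = begin
      binomialDifference 0 n s * (x ^ j * y ^ s)   ≈⟨ *-congʳ bd≈-1 ⟩
      - 1# * (x ^ j * y ^ s)                       ≈⟨ -1*x≈-x _ ⟩
      - (x ^ j * y ^ s)                            ∎
      where
      s : ℕ
      s = n ∸ suc j
      bd≈-1 : binomialDifference 0 n s ≈ - 1#
      bd≈-1 = begin
        (s C n) × 1# - (1# + 0#)   ≈⟨ +-cong (reflexive (≡.cong (_× 1#) (k>n⇒nCk≡0 (ℕ.∸-monoʳ-< (s≤s z≤n) j<n)))) (-‿cong (+-identityʳ 1#)) ⟩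
        0# - 1#                    ≈⟨ +-identityˡ _ ⟩
        - 1#                       ∎

theorem4p2 : {c ℓ : Level} (R : CommutativeRing c ℓ) (x y : CommutativeRing.Carrier R) (m n : ℕ) →
    CommutativeRing._≈_ R (Poly.LHS R x y m n) (Poly.RHS R x y m n)
theorem4p2 R x y = LHS≈RHS
  where
  open CommutativeRing R using (_≈_; -_; _*_; _+_; setoid; -‿cong; *-congˡ; +-cong)
  open Poly R using (M; LHS; RHS)
  open Identity R x y
  open import Relation.Binary.Reasoning.Setoid setoid

  LHS≈RHS : ∀ m n → LHS x y m n ≈ RHS x y m n
  LHS≈RHS zero    n       = begin
    LHS x y 0 n      ≈⟨ LHS-zeroˡ n ⟩
    - M x y n 1      ≈⟨ -‿cong (M-oneʳ n) ⟩
    - geometric n    ≈⟨ RHS-zeroˡ n ⟨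
    RHS x y 0 n      ∎
  LHS≈RHS (suc m) zero    = begin
    LHS x y (suc m) 0    ≈⟨ LHS-zeroʳ (suc m) ⟩
    M x y (suc m) 1      ≈⟨ M-oneʳ (suc m) ⟩
    geometric (suc m)    ≈⟨ RHS-zeroʳ (suc m) ⟨
    RHS x y (suc m) 0    ∎
  LHS≈RHS (suc m) (suc n) = begin
    LHS x y (suc m) (suc n)                        ≈⟨ LHS-pascal m n ⟩
    y * (LHS x y (suc m) n + LHS x y m (suc n))    ≈⟨ *-congˡ (+-cong (LHS≈RHS (suc m) n) (LHS≈RHS m (suc n))) ⟩
    y * (RHS x y (suc m) n + RHS x y m (suc n))    ≈⟨ RHS-pascal m n ⟨
    RHS x y (suc m) (suc n)                        ∎
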